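{- For every prime power $q$, the incidence graph of the Desarguesian affine plane $AG(2,q)$ of order $q$ minus a parallel class of lines is a Cayley graph.
   Context: $AG(2,q)$ is the affine plane over the finite field $GF(q)$: points are elements of $GF(q)^2$, lines are the affine lines; its lines fall into $q+1$ parallel classes of $q$ lines each. Removing one parallel class of lines gives an incidence structure with $q^2$ points and $q^2$ lines; its incidence graph is the bipartite graph on points and remaining lines, with a point adjacent to a line iff incident. A graph is a Cayley graph if it is isomorphic to some $\mathrm{Cay}(G,S)$, where $G$ is a finite group, $S\subseteq G\setminus\{e\}$ is inverse-closed, and $a\sim b$ iff $ab^{ -1}\in S$. -}

module Defs where

open import Level using (0ℓ)
open import Data.Nat using (ℕ)
open import Data.Fin using (Fin)
open import Data.Product using (_×_; _,_; Σ; ∃)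
open import Data.Sum using (_⊎_; inj₁; inj₂)
open import Data.Empty using (⊥)
open import Relation.Nullary using (¬_)
open import Relation.Binary.PropositionalEquality using (_≡_)
open import Function.Bundles using (_↔_; _⇔_; Inverse)
open import Algebra.Bundles using (CommutativeRing; Group)

record IsFiniteField (R : CommutativeRing 0ℓ 0ℓ) : Set where
  open CommutativeRing R
  field
    ≈⇒≡     : ∀ {x y} → x ≈ y → x ≡ y
    0≢1     : ¬ (0# ≡ 1#)
    inverse : ∀ x → ¬ (x ≡ 0#) → ∃ λ y → x * y ≡ 1#
    order   : ℕ
    enum    : Carrier ↔ Fin order

-- Incidence structure AG(2,F) minus the parallel class of vertical lines
-- {x = c}.
module AffineMinusParallelClass (R : CommutativeRing 0ℓ 0ℓ) where
  open CommutativeRing R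

  Point : Set
  Point = Carrier × Carrier

  Line : Set
  Line = Carrier × Carrier

  _on_ : Point → Line → Set
  (x , y) on (m , b) = y ≡ m * x + b

  Vertex : Set
  Vertex = Point ⊎ Line

  Adj : Vertex → Vertex → Set
  Adj (inj₁ p) (inj₁ p′) = ⊥
  Adj (inj₁ p) (inj₂ ℓ)  = p on ℓ
  Adj (inj₂ ℓ) (inj₁ p)  = p on ℓ
  Adj (inj₂ ℓ) (inj₂ ℓ′) = ⊥

record IsCayleyGraph (V : Set) (Adj : V → V → Set) : Set₁ where
  field
    G : Group 0ℓ 0ℓ
  open Group G
  field
    ≈⇒≡        : ∀ {x y} → x ≈ y → x ≡ y
    order      : ℕ
    finite     : Carrier ↔ Fin order
    S          : Carrier → Set
    e∉S        : ¬ S ε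
    inv-closed : ∀ s → S s → S (s ⁻¹)
    φ          : V ↔ Carrier
    iso        : ∀ u v → Adj u v ⇔ S (Inverse.to φ u ∙ (Inverse.to φ v) ⁻¹)

-- The shears (x , y) ↦ (x + a , y + a x + c) of F² form an abelian group H of
-- order q², which acts regularly on the points and, dually, on the non-vertical
-- lines.  In the generalised dihedral group Dih(H) = H ⋊ C₂ send the point
-- (x , y) to the rotation by (x , y) and the line y = m x + b to the reflection
-- in (- m , - b).  A point times the inverse of a line is then the reflection
-- in (x - m , y - m x - b), so incidence means exactly that this reflection
-- lies in S = { reflections in (a , 0) }.
module Submission where

open import Defs
open import Level using (0ℓ)
open import Algebra.Bundles using (AbelianGroup; CommutativeRing; Group)
import Algebra.Properties.AbelianGroup as AbelianGroupProperties
import Algebra.Properties.Group as GroupProperties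
import Algebra.Properties.Ring as RingProperties
import Algebra.Solver.Ring.NaturalCoefficients.Default as SemiringSolver
open import Data.Empty using (⊥)
open import Data.Fin using (Fin)
open import Data.Fin.Properties using (+↔⊎; *↔×)
open import Data.Nat using (ℕ)
import Data.Nat as ℕ
open import Data.Product using (_×_; _,_)
open import Data.Product.Function.NonDependent.Propositional using (_×-↔_)
open import Data.Sum using (_⊎_; inj₁; inj₂)
open import Data.Sum.Function.Propositional using (_⊎-↔_)
open import Function using (id)
open import Function.Bundles using (_↔_; _⇔_; mk⇔; mk↔ₛ′)
open import Function.Properties.Inverse using (↔-sym; ↔-trans)
import Relation.Binary.PropositionalEquality as ≡
open import Relation.Binary.PropositionalEquality
  using (_≡_; cong; cong₂; subst) renaming (isEquivalence to ≡-isEquivalence)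

module GeneralisedDihedral
  (H : AbelianGroup 0ℓ 0ℓ)
  (≈⇒≡ : ∀ {x y} → AbelianGroup._≈_ H x y → x ≡ y)
  where

  open AbelianGroup H
  open AbelianGroupProperties H using (ε⁻¹≈ε; ⁻¹-∙-comm; ⁻¹-anti-homo‿-)

  Dih : Set
  Dih = Carrier ⊎ Carrier

  pattern rot h = inj₁ h
  pattern ref k = inj₂ k

  infixl 7 _·_
  _·_ : Dih → Dih → Dih
  rot h · rot h′ = rot (h ∙ h′)
  rot h · ref k  = ref (h ∙ k)
  ref k · rot h  = ref (k - h)
  ref k · ref k′ = rot (k - k′)

  inv : Dih → Dih
  inv (rot h) = rot (h ⁻¹)
  inv (ref k) = ref k

  e : Dih
  e = rot ε

  -‿-‿assoc : ∀ x y z → x - y - z ≡ x - (y ∙ z)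
  -‿-‿assoc x y z = ≈⇒≡ (begin
    x - y - z           ≈⟨ assoc x (y ⁻¹) (z ⁻¹) ⟩
    x ∙ (y ⁻¹ ∙ z ⁻¹)   ≈⟨ ∙-congˡ (⁻¹-∙-comm y z) ⟩
    x - (y ∙ z)         ∎)
    where open import Relation.Binary.Reasoning.Setoid setoid

  -‿∙‿assoc : ∀ x y z → (x - y) ∙ z ≡ x - (y - z)
  -‿∙‿assoc x y z = ≈⇒≡ (begin
    (x - y) ∙ z         ≈⟨ assoc x (y ⁻¹) z ⟩
    x ∙ (y ⁻¹ ∙ z)      ≈⟨ ∙-congˡ (comm (y ⁻¹) z) ⟩
    x ∙ (z - y)         ≈⟨ ∙-congˡ (⁻¹-anti-homo‿- y z) ⟨
    x - (y - z)         ∎)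
    where open import Relation.Binary.Reasoning.Setoid setoid

  ·-assoc : ∀ x y z → (x · y) · z ≡ x · (y · z)
  ·-assoc (rot h) (rot h′) (rot h″) = cong rot (≈⇒≡ (assoc h h′ h″))
  ·-assoc (rot h) (rot h′) (ref k)  = cong ref (≈⇒≡ (assoc h h′ k))
  ·-assoc (rot h) (ref k)  (rot h′) = cong ref (≈⇒≡ (assoc h k (h′ ⁻¹)))
  ·-assoc (rot h) (ref k)  (ref k′) = cong rot (≈⇒≡ (assoc h k (k′ ⁻¹)))
  ·-assoc (ref k) (rot h)  (rot h′) = cong ref (-‿-‿assoc k h h′)
  ·-assoc (ref k) (rot h)  (ref k′) = cong rot (-‿-‿assoc k h k′)
  ·-assoc (ref k) (ref k′) (rot h)  = cong rot (-‿∙‿assoc k k′ h)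
  ·-assoc (ref k) (ref k′) (ref k″) = cong ref (-‿∙‿assoc k k′ k″)

  ·-identityˡ : ∀ x → e · x ≡ x
  ·-identityˡ (rot h) = cong rot (≈⇒≡ (identityˡ h))
  ·-identityˡ (ref k) = cong ref (≈⇒≡ (identityˡ k))

  ·-identityʳ : ∀ x → x · e ≡ x
  ·-identityʳ (rot h) = cong rot (≈⇒≡ (identityʳ h))
  ·-identityʳ (ref k) = cong ref (≈⇒≡ (trans (∙-congˡ ε⁻¹≈ε) (identityʳ k)))

  ·-inverseˡ : ∀ x → inv x · x ≡ e
  ·-inverseˡ (rot h) = cong rot (≈⇒≡ (inverseˡ h))
  ·-inverseˡ (ref k) = cong rot (≈⇒≡ (inverseʳ k))

  ·-inverseʳ : ∀ x → x · inv x ≡ e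
  ·-inverseʳ (rot h) = cong rot (≈⇒≡ (inverseʳ h))
  ·-inverseʳ (ref k) = cong rot (≈⇒≡ (inverseʳ k))

  dihedralGroup : Group 0ℓ 0ℓ
  dihedralGroup = record
    { Carrier = Dih ; _≈_ = _≡_ ; _∙_ = _·_ ; ε = e ; _⁻¹ = inv
    ; isGroup = record
      { isMonoid = record
        { isSemigroup = record
          { isMagma = record { isEquivalence = ≡-isEquivalence ; ∙-cong = cong₂ _·_ }
          ; assoc = ·-assoc }
        ; identity = ·-identityˡ , ·-identityʳ }
      ; inverse = ·-inverseˡ , ·-inverseʳ
      ; ⁻¹-cong = cong inv } }

module ShearGroup
  (R : CommutativeRing 0ℓ 0ℓ)
  (≈⇒≡ : ∀ {x y} → CommutativeRing._≈_ R x y → x ≡ y)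
  where

  open CommutativeRing R
  open RingProperties ring using (-‿distribˡ-*)
  open SemiringSolver commutativeSemiring using (solve; _:+_; _:*_; _:=_)
  open import Relation.Binary.Reasoning.Setoid setoid

  Shear : Set
  Shear = Carrier × Carrier

  -- (a , c) is the shear (x , y) ↦ (x + a , y + a x + c); composing two of them
  -- produces the cross term a a′.
  _⊕_ : Shear → Shear → Shear
  (a , c) ⊕ (a′ , c′) = (a + a′ , c + c′ + a * a′)

  ⊖_ : Shear → Shear
  ⊖ (a , c) = (- a , - c + a * a)

  𝟎 : Shear
  𝟎 = (0# , 0#)

  pair-≈ : ∀ {a c a′ c′} → a ≈ a′ → c ≈ c′ → (a , c) ≡ (a′ , c′)
  pair-≈ p q = cong₂ _,_ (≈⇒≡ p) (≈⇒≡ q)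

  ⊕-assoc : ∀ s t u → (s ⊕ t) ⊕ u ≡ s ⊕ (t ⊕ u)
  ⊕-assoc (a , c) (a′ , c′) (a″ , c″) = pair-≈ (+-assoc a a′ a″)
    (solve 6 (λ a c a′ c′ a″ c″ →
         (c :+ c′ :+ a :* a′) :+ c″ :+ (a :+ a′) :* a″
      := c :+ (c′ :+ c″ :+ a′ :* a″) :+ a :* (a′ :+ a″)) refl a c a′ c′ a″ c″)

  ⊕-comm : ∀ s t → s ⊕ t ≡ t ⊕ s
  ⊕-comm (a , c) (a′ , c′) = pair-≈ (+-comm a a′) (+-cong (+-comm c c′) (*-comm a a′))

  ⊕-identityˡ : ∀ s → 𝟎 ⊕ s ≡ s
  ⊕-identityˡ (a , c) = pair-≈ (+-identityˡ a) (begin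
    0# + c + 0# * a   ≈⟨ +-cong (+-identityˡ c) (zeroˡ a) ⟩
    c + 0#            ≈⟨ +-identityʳ c ⟩
    c                 ∎)

  ⊕-inverseˡ : ∀ s → (⊖ s) ⊕ s ≡ 𝟎
  ⊕-inverseˡ (a , c) = pair-≈ (-‿inverseˡ a) (begin
    (- c + a * a) + c + - a * a
      ≈⟨ solve 4 (λ c c⁻ aa a⁻a → (c⁻ :+ aa) :+ c :+ a⁻a := (c :+ c⁻) :+ (aa :+ a⁻a))
           refl c (- c) (a * a) (- a * a) ⟩
    (c + - c) + (a * a + - a * a)
      ≈⟨ +-cong (-‿inverseʳ c) (+-congˡ (sym (-‿distribˡ-* a a))) ⟩
    0# + (a * a + - (a * a))
      ≈⟨ +-identityˡ _ ⟩
    a * a + - (a * a)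
      ≈⟨ -‿inverseʳ (a * a) ⟩
    0#  ∎)

  shearGroup : AbelianGroup 0ℓ 0ℓ
  shearGroup = record
    { Carrier = Shear ; _≈_ = _≡_ ; _∙_ = _⊕_ ; ε = 𝟎 ; _⁻¹ = ⊖_
    ; isAbelianGroup = record
      { isGroup = record
        { isMonoid = record
          { isSemigroup = record
            { isMagma = record { isEquivalence = ≡-isEquivalence ; ∙-cong = cong₂ _⊕_ }
            ; assoc = ⊕-assoc }
          ; identity = ⊕-identityˡ , λ s → subst (_≡ s) (⊕-comm 𝟎 s) (⊕-identityˡ s) }
        ; inverse = ⊕-inverseˡ , λ s → subst (_≡ 𝟎) (⊕-comm (⊖ s) s) (⊕-inverseˡ s)
        ; ⁻¹-cong = cong ⊖_ }
      ; comm = ⊕-comm } }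

module AffinePlaneCayley
  (R : CommutativeRing 0ℓ 0ℓ)
  (≈⇒≡ : ∀ {x y} → CommutativeRing._≈_ R x y → x ≡ y)
  where

  open CommutativeRing R
  open RingProperties ring using (-‿distribʳ-*; -‿+-comm; -‿involutive; x∙y⁻¹≈ε⇒x≈y; x≈y⇒x∙y⁻¹≈ε)
  open AffineMinusParallelClass R
  open ShearGroup R ≈⇒≡
  open GeneralisedDihedral shearGroup id
  open import Relation.Binary.Reasoning.Setoid setoid

  toDih : Vertex → Dih
  toDih (inj₁ p)       = rot p
  toDih (inj₂ (m , b)) = ref (- m , - b)

  toDih-involutive : ∀ v → toDih (toDih v) ≡ v
  toDih-involutive (inj₁ p)       = ≡.refl
  toDih-involutive (inj₂ (m , b)) = cong ref (pair-≈ (-‿involutive m) (-‿involutive b))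

  toDih-↔ : Vertex ↔ Dih
  toDih-↔ = mk↔ₛ′ toDih toDih toDih-involutive toDih-involutive

  S : Dih → Set
  S (rot _)       = ⊥
  S (ref (_ , c)) = c ≡ 0#

  line-offset : ∀ x y m b → y + - b + x * - m ≈ y + - (m * x + b)
  line-offset x y m b = begin
    y + - b + x * - m      ≈⟨ +-assoc y (- b) (x * - m) ⟩
    y + (- b + x * - m)    ≈⟨ +-congˡ (+-congˡ (-‿distribʳ-* x m)) ⟨
    y + (- b + - (x * m))  ≈⟨ +-congˡ (+-congˡ (-‿cong (*-comm x m))) ⟩
    y + (- b + - (m * x))  ≈⟨ +-congˡ (+-comm (- b) (- (m * x))) ⟩
    y + (- (m * x) + - b)  ≈⟨ +-congˡ (-‿+-comm (m * x) b) ⟩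
    y + - (m * x + b)      ∎

  on⇔offset≡0 : ∀ x y m b → (x , y) on (m , b) ⇔ y + - b + x * - m ≡ 0#
  on⇔offset≡0 x y m b = mk⇔
    (λ y≡mx+b → ≈⇒≡ (trans (line-offset x y m b) (x≈y⇒x∙y⁻¹≈ε (reflexive y≡mx+b))))
    (λ offset≡0 → ≈⇒≡ (x∙y⁻¹≈ε⇒x≈y y (m * x + b)
      (trans (sym (line-offset x y m b)) (reflexive offset≡0))))

  open Group dihedralGroup using (_//_)
  open GroupProperties dihedralGroup using (⁻¹-anti-homo-//)

  adjacency⇔S : ∀ u v → Adj u v ⇔ S (toDih u // toDih v)
  adjacency⇔S (inj₁ p)       (inj₁ p′)      = mk⇔ id id
  adjacency⇔S (inj₁ (x , y)) (inj₂ (m , b)) = on⇔offset≡0 x y m b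
  -- toDih p // toDih ℓ is a reflection, hence its own inverse toDih ℓ // toDih p.
  adjacency⇔S (inj₂ ℓ)       (inj₁ p)       =
    subst (λ g → Adj (inj₁ p) (inj₂ ℓ) ⇔ S g) (⁻¹-anti-homo-// (toDih (inj₁ p)) (toDih (inj₂ ℓ)))
      (adjacency⇔S (inj₁ p) (inj₂ ℓ))
  adjacency⇔S (inj₂ ℓ)       (inj₂ ℓ′)      = mk⇔ id id

  S-inverseClosed : ∀ s → S s → S (inv s)
  S-inverseClosed (ref _) s∈S = s∈S

  isCayleyGraph : (q : ℕ) → Carrier ↔ Fin q → IsCayleyGraph Vertex Adj
  isCayleyGraph q enum = record
    { G = dihedralGroup ; ≈⇒≡ = id ; order = q ℕ.* q ℕ.+ q ℕ.* q ; finite = finite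
    ; S = S ; e∉S = id ; inv-closed = S-inverseClosed ; φ = toDih-↔ ; iso = adjacency⇔S }
    where
    square : Shear ↔ Fin (q ℕ.* q)
    square = ↔-trans (enum ×-↔ enum) (↔-sym *↔×)

    finite : Dih ↔ Fin (q ℕ.* q ℕ.+ q ℕ.* q)
    finite = ↔-trans (square ⊎-↔ square) (↔-sym +↔⊎)

proposition3p2 : (F : CommutativeRing 0ℓ 0ℓ) → IsFiniteField F → IsCayleyGraph (AffineMinusParallelClass.Vertex F) (AffineMinusParallelClass.Adj F)
proposition3p2 F isFiniteField = AffinePlaneCayley.isCayleyGraph F ≈⇒≡ order enum
  where open IsFiniteField isFiniteField
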